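{- Let $U,V,X$ be integers with $V\ge1$, $X\ge1$ and $|U|\ge 2X$, and let $\rho=\dfrac{(V+1)^{2X}}{V^X}\in\mathbb{Q}$. Then \[ \left|\frac{\psi_{2X+1}(U(V+1))}{\psi_{X+1}(U^2V)}-\rho\right|\le\rho\,\frac{2X}{|U|V}. \]
   Context: For $A\in\mathbb{Z}$, $(\psi_m(A))_{m\in\mathbb{Z}}$ is the integer sequence with $\psi_0(A)=0$, $\psi_1(A)=1$ and $\psi_{m+1}(A)=A\psi_m(A)-\psi_{m-1}(A)$ for all $m\in\mathbb{Z}$. -}

module Defs where

open import Data.Nat as ℕ using (ℕ; zero; suc)
open import Data.Integer as ℤ using (ℤ; +_; -[1+_]; _-_; _*_)
open import Data.Rational as ℚ using (ℚ; _÷_; 0ℚ)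
open import Relation.Nullary using (yes; no)
open import Relation.Binary.PropositionalEquality using (_≡_)

ψℕ : ℕ → ℤ → ℤ
ψℕ zero A = + 0
ψℕ (suc zero) A = + 1
ψℕ (suc (suc m)) A = A * ψℕ (suc m) A - ψℕ m A

-- The unique extension to all m ∈ ℤ satisfying the recurrence: ψ_{-m} = -ψ_m.
ψ : ℤ → ℤ → ℤ
ψ (+ m) A = ψℕ m A
ψ -[1+ m ] A = ℤ.- ψℕ (suc m) A

-- Rational division, used only where the conclusion separately asserts
-- that the denominator is nonzero (the junk value 0 is never used then).
_/ℚ_ : ℚ → ℚ → ℚ
p /ℚ q with q ℚ.≟ 0ℚ
... | yes _ = 0ℚ
... | no q≢0 = (p ÷ q) {{ℚ.≢-nonZero q≢0}}

ℤ→ℚ : ℤ → ℚ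
ℤ→ℚ z = z ℚ./ 1

-- Put n = X, A = U(V+1), a = A² and b = U²V.  The odd-indexed values ψ_{2k+1}(A) satisfy
-- s_{k+2} = (a−2) s_{k+1} − s_k and the values ψ_{k+1}(b) satisfy s_{k+2} = b s_{k+1} − s_k.
-- A recurrence s_{k+2} = t s_{k+1} − s_k with s_0 = 1 and t ≥ 2 is nondecreasing, hence squeezed
-- between (t−1)^k and M^k; with Bernoulli's inequality this gives
--   a^{n−1}(a − 3n) ≤ ψ_{2n+1}(A) ≤ a^n   and   b^{n−1}(b − n) ≤ ψ_{n+1}(b) ≤ b^n.
-- These bound the cross difference ψ_{2n+1}(A) b^n − a^n ψ_{n+1}(b) on both sides by a^n·2n·ψ_{n+1}(b)/(|U|V),
-- using only the polynomial inequalities |U|V ≤ 2(b − n) and 3b|U|V ≤ 2a(b − n), valid for |U| ≥ 2n.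
-- Cancelling the common factor |U|^{2n} of a^n = |U|^{2n}(V+1)^{2n} and b^n = |U|^{2n}V^n leaves the
-- claim with all denominators cleared.

module Submission where

open import Defs
open import Data.Nat as ℕ using (ℕ; zero; suc)
import Data.Nat.Properties as ℕP
import Data.Nat.Tactic.RingSolver as ℕ-Solver
open import Data.Integer as ℤ using (ℤ; +_; -[1+_]; 0ℤ; 1ℤ; _+_; _-_; -_; _*_; _^_; _≤_; ∣_∣)
import Data.Integer.Properties as ℤP
open import Data.Integer.Tactic.RingSolver using (solve-∀)
open import Data.Rational as ℚ using (ℚ; mkℚ; 0ℚ; toℚᵘ)
open import Data.Rational.Unnormalised as ℚᵘ using (mkℚᵘ; *≡*; *≤*) renaming (_≃_ to _≃ᵘ_)
import Data.Rational.Properties as ℚP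
import Data.Rational.Unnormalised.Properties as ℚᵘP
open import Data.Empty using (⊥-elim)
open import Data.Product using (_×_; _,_; proj₁; proj₂)
open import Data.Sum using (inj₁; inj₂)
open import Relation.Nullary using (yes; no)
open import Relation.Binary.PropositionalEquality
  using (_≡_; _≢_; refl; sym; trans; cong; cong₂; subst; subst₂)

open ℤP.≤-Reasoning

0≤+ : ∀ n → 0ℤ ≤ + n
0≤+ n = ℤ.+≤+ ℕ.z≤n

*-monoˡ-≤-0≤ : ∀ {k i j} → 0ℤ ≤ k → i ≤ j → k * i ≤ k * j
*-monoˡ-≤-0≤ {k} 0≤k = ℤP.*-monoˡ-≤-nonNeg k {{ℤ.nonNegative 0≤k}}

*-monoʳ-≤-0≤ : ∀ {k i j} → 0ℤ ≤ k → i ≤ j → i * k ≤ j * k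
*-monoʳ-≤-0≤ {k} 0≤k = ℤP.*-monoʳ-≤-nonNeg k {{ℤ.nonNegative 0≤k}}

0≤* : ∀ {i j} → 0ℤ ≤ i → 0ℤ ≤ j → 0ℤ ≤ i * j
0≤* {i} 0≤i 0≤j = ℤP.≤-trans (ℤP.≤-reflexive (sym (ℤP.*-zeroʳ i))) (*-monoˡ-≤-0≤ 0≤i 0≤j)

0≤^ : ∀ {i} n → 0ℤ ≤ i → 0ℤ ≤ i ^ n
0≤^ zero    _   = 0≤+ 1
0≤^ (suc n) 0≤i = 0≤* 0≤i (0≤^ n 0≤i)

minus-mono-≤ : ∀ {i j k l} → i ≤ j → l ≤ k → i - k ≤ j - l
minus-mono-≤ i≤j l≤k = ℤP.+-mono-≤ i≤j (ℤP.neg-mono-≤ l≤k)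

i≤k*i : ∀ {i k} → 0ℤ ≤ i → 1ℤ ≤ k → i ≤ k * i
i≤k*i {i} 0≤i 1≤k = ℤP.≤-trans (ℤP.≤-reflexive (sym (ℤP.*-identityˡ i))) (*-monoʳ-≤-0≤ 0≤i 1≤k)

1≤* : ∀ {i j} → 1ℤ ≤ i → 1ℤ ≤ j → 1ℤ ≤ i * j
1≤* 1≤i 1≤j = ℤP.≤-trans 1≤j (i≤k*i (ℤP.≤-trans (0≤+ 1) 1≤j) 1≤i)

1≤^ : ∀ {i} n → 1ℤ ≤ i → 1ℤ ≤ i ^ n
1≤^ zero    _   = ℤP.≤-refl
1≤^ (suc n) 1≤i = 1≤* 1≤i (1≤^ n 1≤i)

+∣i∣*j≤k : ∀ {i j k} → i * j ≤ k → (- i) * j ≤ k → + ∣ i ∣ * j ≤ k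
+∣i∣*j≤k {i} {j} {k} i*j≤k -i*j≤k with ℤP.+∣i∣≡i⊎+∣i∣≡-i i
... | inj₁ ∣i∣≡i  = subst (λ z → z * j ≤ k) (sym ∣i∣≡i) i*j≤k
... | inj₂ ∣i∣≡-i = subst (λ z → z * j ≤ k) (sym ∣i∣≡-i) -i*j≤k

+∣i*j∣≡+∣i∣*j : ∀ i {j} → 0ℤ ≤ j → + ∣ i * j ∣ ≡ + ∣ i ∣ * j
+∣i*j∣≡+∣i∣*j i {j} 0≤j = begin-equality
  + ∣ i * j ∣          ≡⟨ cong +_ (ℤP.∣i*j∣≡∣i∣*∣j∣ i j) ⟩
  + (∣ i ∣ ℕ.* ∣ j ∣)  ≡⟨ ℤP.pos-* ∣ i ∣ ∣ j ∣ ⟩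
  + ∣ i ∣ * + ∣ j ∣    ≡⟨ cong (+ ∣ i ∣ *_) (ℤP.0≤i⇒+∣i∣≡i 0≤j) ⟩
  + ∣ i ∣ * j          ∎

i*i≡∣i∣*∣i∣ : ∀ i → i * i ≡ + ∣ i ∣ * + ∣ i ∣
i*i≡∣i∣*∣i∣ (+ _)    = refl
i*i≡∣i∣*∣i∣ -[1+ _ ] = refl

[i*j]²≡∣i∣²*j² : ∀ i j → i * j * (i * j) ≡ + ∣ i ∣ * + ∣ i ∣ * (j * j)
[i*j]²≡∣i∣²*j² i j = trans (e i j) (cong (_* (j * j)) (i*i≡∣i∣*∣i∣ i))
  where
  e : ∀ i j → i * j * (i * j) ≡ i * i * (j * j)
  e = solve-∀

^-distribʳ-* : ∀ i j n → (i * j) ^ n ≡ i ^ n * j ^ n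
^-distribʳ-* i j zero    = refl
^-distribʳ-* i j (suc n) = trans (cong (i * j *_) (^-distribʳ-* i j n)) (e i j (i ^ n) (j ^ n))
  where
  e : ∀ i j x y → i * j * (x * y) ≡ i * x * (j * y)
  e = solve-∀

module RecurrenceBounds
  (s : ℕ → ℤ) {t M : ℤ}
  (recurrence : ∀ k → s (suc (suc k)) ≡ t * s (suc k) - s k)
  (2≤t : + 2 ≤ t) (t≤M : t ≤ M)
  (s₀≡1 : s 0 ≡ 1ℤ) (t-1≤s₁ : t - 1ℤ ≤ s 1) (s₁≤M : s 1 ≤ M)
  where

  1≤t-1 : 1ℤ ≤ t - 1ℤ
  1≤t-1 = ℤP.+-monoˡ-≤ (- 1ℤ) 2≤t

  0≤t-1 : 0ℤ ≤ t - 1ℤ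
  0≤t-1 = ℤP.≤-trans (0≤+ 1) 1≤t-1

  0≤M : 0ℤ ≤ M
  0≤M = ℤP.≤-trans (0≤+ 2) (ℤP.≤-trans 2≤t t≤M)

  lower-step : ∀ k → s k ≤ s (suc k) → (t - 1ℤ) * s (suc k) ≤ s (suc (suc k))
  lower-step k sₖ≤sₖ₊₁ = begin
    (t - 1ℤ) * s (suc k)      ≡⟨ e t (s (suc k)) ⟩
    t * s (suc k) - s (suc k) ≤⟨ minus-mono-≤ (ℤP.≤-refl {t * s (suc k)}) sₖ≤sₖ₊₁ ⟩
    t * s (suc k) - s k       ≡⟨ sym (recurrence k) ⟩
    s (suc (suc k))           ∎
    where
    e : ∀ t x → (t - 1ℤ) * x ≡ t * x - x
    e = solve-∀

  nonNeg-nonDecreasing : ∀ k → 0ℤ ≤ s k × s k ≤ s (suc k)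
  nonNeg-nonDecreasing zero rewrite s₀≡1 = 0≤+ 1 , ℤP.≤-trans 1≤t-1 t-1≤s₁
  nonNeg-nonDecreasing (suc k) with nonNeg-nonDecreasing k
  ... | 0≤sₖ , sₖ≤sₖ₊₁ = 0≤sₖ₊₁ , (begin
    s (suc k)             ≡⟨ sym (ℤP.*-identityˡ (s (suc k))) ⟩
    1ℤ * s (suc k)        ≤⟨ *-monoʳ-≤-0≤ 0≤sₖ₊₁ 1≤t-1 ⟩
    (t - 1ℤ) * s (suc k)  ≤⟨ lower-step k sₖ≤sₖ₊₁ ⟩
    s (suc (suc k))       ∎)
    where
    0≤sₖ₊₁ = ℤP.≤-trans 0≤sₖ sₖ≤sₖ₊₁

  0≤s : ∀ k → 0ℤ ≤ s k
  0≤s k = proj₁ (nonNeg-nonDecreasing k)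

  t-1*s≤s : ∀ k → (t - 1ℤ) * s k ≤ s (suc k)
  t-1*s≤s zero rewrite s₀≡1 | ℤP.*-identityʳ (t - 1ℤ) = t-1≤s₁
  t-1*s≤s (suc k) = lower-step k (proj₂ (nonNeg-nonDecreasing k))

  s≤M*s : ∀ k → s (suc k) ≤ M * s k
  s≤M*s zero rewrite s₀≡1 | ℤP.*-identityʳ M = s₁≤M
  s≤M*s (suc k) = begin
    s (suc (suc k))            ≡⟨ recurrence k ⟩
    t * s (suc k) - s k        ≤⟨ ℤP.i-j≤i (t * s (suc k)) (s k) {{ℤ.nonNegative (0≤s k)}} ⟩
    t * s (suc k)              ≤⟨ *-monoʳ-≤-0≤ (0≤s (suc k)) t≤M ⟩
    M * s (suc k)              ∎

  lower-bound : ∀ k → (t - 1ℤ) ^ k ≤ s k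
  lower-bound zero rewrite s₀≡1 = ℤP.≤-refl
  lower-bound (suc k) = begin
    (t - 1ℤ) * (t - 1ℤ) ^ k   ≤⟨ *-monoˡ-≤-0≤ 0≤t-1 (lower-bound k) ⟩
    (t - 1ℤ) * s k            ≤⟨ t-1*s≤s k ⟩
    s (suc k)                 ∎

  upper-bound : ∀ k → s k ≤ M ^ k
  upper-bound zero rewrite s₀≡1 = ℤP.≤-refl
  upper-bound (suc k) = begin
    s (suc k)    ≤⟨ s≤M*s k ⟩
    M * s k      ≤⟨ *-monoˡ-≤-0≤ 0≤M (upper-bound k) ⟩
    M * M ^ k    ∎

ψℕ-double-step : ∀ A j → ψℕ (4 ℕ.+ j) A ≡ (A * A - + 2) * ψℕ (2 ℕ.+ j) A - ψℕ j A
ψℕ-double-step A j = e A (ψℕ (suc j) A) (ψℕ j A)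
  where
  e : ∀ A y x → A * (A * (A * y - x) - y) - (A * y - x) ≡ (A * A - + 2) * (A * y - x) - x
  e = solve-∀

ψℕ-odd-bounds : ∀ A k → + 4 ≤ A * A →
  (A * A - + 3) ^ k ≤ ψℕ (2 ℕ.* k ℕ.+ 1) A × ψℕ (2 ℕ.* k ℕ.+ 1) A ≤ (A * A) ^ k
ψℕ-odd-bounds A k 4≤A² =
  subst (λ c → c ^ k ≤ ψℕ (2 ℕ.* k ℕ.+ 1) A) (e₁ (A * A)) (lower-bound k) , upper-bound k
  where
  s : ℕ → ℤ
  s k = ψℕ (2 ℕ.* k ℕ.+ 1) A
  index₁ : ∀ k → 2 ℕ.* (1 ℕ.+ k) ℕ.+ 1 ≡ 2 ℕ.+ (2 ℕ.* k ℕ.+ 1)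
  index₁ = ℕ-Solver.solve-∀
  index₂ : ∀ k → 2 ℕ.* (2 ℕ.+ k) ℕ.+ 1 ≡ 4 ℕ.+ (2 ℕ.* k ℕ.+ 1)
  index₂ = ℕ-Solver.solve-∀
  recurrence : ∀ k → s (2 ℕ.+ k) ≡ (A * A - + 2) * s (1 ℕ.+ k) - s k
  recurrence k = begin-equality
    ψℕ (2 ℕ.* (2 ℕ.+ k) ℕ.+ 1) A      ≡⟨ cong (λ i → ψℕ i A) (index₂ k) ⟩
    ψℕ (4 ℕ.+ (2 ℕ.* k ℕ.+ 1)) A      ≡⟨ ψℕ-double-step A (2 ℕ.* k ℕ.+ 1) ⟩
    (A * A - + 2) * ψℕ (2 ℕ.+ (2 ℕ.* k ℕ.+ 1)) A - s k
      ≡⟨ cong (λ i → (A * A - + 2) * ψℕ i A - s k) (sym (index₁ k)) ⟩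
    (A * A - + 2) * s (1 ℕ.+ k) - s k ∎
  e₁ : ∀ x → x - + 2 - 1ℤ ≡ x - + 3
  e₁ = solve-∀
  e₂ : ∀ A → A * (A * 1ℤ - 0ℤ) - 1ℤ ≡ A * A - 1ℤ
  e₂ = solve-∀
  open RecurrenceBounds s {A * A - + 2} {A * A} recurrence
    (ℤP.+-monoˡ-≤ (- + 2) 4≤A²) (ℤP.i-j≤i (A * A) (+ 2)) refl
    (begin
      A * A - + 2 - 1ℤ  ≡⟨ e₁ (A * A) ⟩
      A * A - + 3       ≤⟨ minus-mono-≤ (ℤP.≤-refl {A * A}) (ℤ.+≤+ (ℕ.s≤s ℕ.z≤n)) ⟩
      A * A - 1ℤ        ≡⟨ sym (e₂ A) ⟩
      ψℕ 3 A            ∎)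
    (ℤP.≤-trans (ℤP.≤-reflexive (e₂ A)) (ℤP.i-j≤i (A * A) 1ℤ))

ψℕ-suc-bounds : ∀ B k → + 2 ≤ B → (B - 1ℤ) ^ k ≤ ψℕ (suc k) B × ψℕ (suc k) B ≤ B ^ k
ψℕ-suc-bounds B k 2≤B = lower-bound k , upper-bound k
  where
  ψ₂≡B : ψℕ 2 B ≡ B
  ψ₂≡B = trans (ℤP.+-identityʳ (B * 1ℤ)) (ℤP.*-identityʳ B)
  open RecurrenceBounds (λ k → ψℕ (suc k) B) {B} {B} (λ k → refl) 2≤B ℤP.≤-refl refl
    (subst (B - 1ℤ ≤_) (sym ψ₂≡B) (ℤP.i-j≤i B 1ℤ)) (ℤP.≤-reflexive ψ₂≡B)

bernoulli : ∀ {x c} m → 0ℤ ≤ c → c ≤ x → x ^ m * (x - + suc m * c) ≤ (x - c) ^ suc m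
bernoulli {x} {c} zero _ _ = ℤP.≤-reflexive (e x c)
  where
  e : ∀ x c → 1ℤ * (x - 1ℤ * c) ≡ (x - c) * 1ℤ
  e = solve-∀
bernoulli {x} {c} (suc m) 0≤c c≤x = begin
  x ^ suc m * (x - k′ * c)                       ≤⟨ ℤP.i≤i+j _ _ {{ℤ.nonNegative 0≤kccxᵐ}} ⟩
  x ^ suc m * (x - k′ * c) + k * c * c * x ^ m   ≡⟨ e x c (x ^ m) k ⟩
  (x - c) * (x ^ m * (x - k * c))                ≤⟨ *-monoˡ-≤-0≤ 0≤x-c (bernoulli m 0≤c c≤x) ⟩
  (x - c) * (x - c) ^ suc m                      ∎
  where
  k k′ : ℤ
  k = + suc m
  k′ = + suc (suc m)
  0≤x-c : 0ℤ ≤ x - c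
  0≤x-c = ℤP.i≤j⇒0≤j-i c≤x
  0≤kccxᵐ : 0ℤ ≤ k * c * c * x ^ m
  0≤kccxᵐ = 0≤* (0≤* (0≤* (0≤+ (suc m)) 0≤c) 0≤c) (0≤^ m (ℤP.≤-trans 0≤c c≤x))
  e : ∀ x c y k → x * y * (x - (1ℤ + k) * c) + k * c * c * y ≡ (x - c) * (y * (x - k * c))
  e = solve-∀

ψℕ-odd-sandwich : ∀ {A a} m → A * A ≡ a → + 4 ≤ a →
  a ^ m * (a - + suc m * + 3) ≤ ψℕ (2 ℕ.* suc m ℕ.+ 1) A × ψℕ (2 ℕ.* suc m ℕ.+ 1) A ≤ a ^ suc m
ψℕ-odd-sandwich {A} m refl 4≤a =
  ℤP.≤-trans (bernoulli m (0≤+ 3) 3≤a) (proj₁ bounds) , proj₂ bounds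
  where
  bounds = ψℕ-odd-bounds A (suc m) 4≤a
  3≤a = ℤP.≤-trans (ℤ.+≤+ (ℕP.n≤1+n 3)) 4≤a

ψℕ-suc-sandwich : ∀ {b} m → + 2 ≤ b →
  b ^ m * (b - + suc m) ≤ ψℕ (2 ℕ.+ m) b × ψℕ (2 ℕ.+ m) b ≤ b ^ suc m
ψℕ-suc-sandwich {b} m 2≤b =
  ℤP.≤-trans (subst (λ x → b ^ m * (b - x) ≤ (b - 1ℤ) ^ suc m) (ℤP.*-identityʳ (+ suc m))
                    (bernoulli m (0≤+ 1) 1≤b))
             (proj₁ bounds) , proj₂ bounds
  where
  bounds = ψℕ-suc-bounds b (suc m) 2≤b
  1≤b = ℤP.≤-trans (ℤ.+≤+ (ℕ.s≤s ℕ.z≤n)) 2≤b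

1≤ψℕ-suc : ∀ {b} k → + 2 ≤ b → 1ℤ ≤ ψℕ (suc k) b
1≤ψℕ-suc {b} k 2≤b = ℤP.≤-trans (1≤^ k (ℤP.+-monoˡ-≤ (- 1ℤ) 2≤b)) (proj₁ (ψℕ-suc-bounds b k 2≤b))

4*v≤[v+1]² : ∀ {v} → 1ℤ ≤ v → + 4 * v ≤ (v + 1ℤ) * (v + 1ℤ)
4*v≤[v+1]² {v} 1≤v = begin
  + 4 * v                            ≤⟨ ℤP.i≤i+j _ _ {{ℤ.nonNegative (0≤* 0≤v-1 0≤v-1)}} ⟩
  + 4 * v + (v - 1ℤ) * (v - 1ℤ)      ≡⟨ e v ⟩
  (v + 1ℤ) * (v + 1ℤ)                ∎
  where
  0≤v-1 = ℤP.i≤j⇒0≤j-i 1≤v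
  e : ∀ v → + 4 * v + (v - 1ℤ) * (v - 1ℤ) ≡ (v + 1ℤ) * (v + 1ℤ)
  e = solve-∀

module Parameters {u v k : ℤ} (1≤k : 1ℤ ≤ k) (2k≤u : + 2 * k ≤ u) (1≤v : 1ℤ ≤ v) where

  a b T : ℤ
  a = u * u * ((v + 1ℤ) * (v + 1ℤ))
  b = u * u * v
  T = u * v

  2≤2k : + 2 ≤ + 2 * k
  2≤2k = *-monoˡ-≤-0≤ (0≤+ 2) 1≤k

  1≤u : 1ℤ ≤ u
  1≤u = ℤP.≤-trans (ℤ.+≤+ (ℕ.s≤s ℕ.z≤n)) (ℤP.≤-trans 2≤2k 2k≤u)

  0≤u : 0ℤ ≤ u
  0≤u = ℤP.≤-trans (0≤+ 1) 1≤u

  0≤v : 0ℤ ≤ v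
  0≤v = ℤP.≤-trans (0≤+ 1) 1≤v

  0≤T : 0ℤ ≤ T
  0≤T = 0≤* 0≤u 0≤v

  0≤u² : 0ℤ ≤ u * u
  0≤u² = 0≤* 0≤u 0≤u

  1≤u² : 1ℤ ≤ u * u
  1≤u² = ℤP.≤-trans 1≤u (i≤k*i 0≤u 1≤u)

  0≤b : 0ℤ ≤ b
  0≤b = 0≤* 0≤u² 0≤v

  2k≤T : + 2 * k ≤ T
  2k≤T = begin
    + 2 * k  ≤⟨ 2k≤u ⟩
    u        ≡⟨ sym (ℤP.*-identityʳ u) ⟩
    u * 1ℤ   ≤⟨ *-monoˡ-≤-0≤ 0≤u 1≤v ⟩
    T        ∎

  1≤T : 1ℤ ≤ T
  1≤T = ℤP.≤-trans (ℤ.+≤+ (ℕ.s≤s ℕ.z≤n)) (ℤP.≤-trans 2≤2k 2k≤T)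

  T≤b : T ≤ b
  T≤b = begin
    T        ≤⟨ i≤k*i 0≤T 1≤u ⟩
    u * T    ≡⟨ ℤP.*-assoc u u v ⟨
    b        ∎

  2k≤b : + 2 * k ≤ b
  2k≤b = ℤP.≤-trans 2k≤T T≤b

  2≤b : + 2 ≤ b
  2≤b = ℤP.≤-trans 2≤2k 2k≤b

  4T≤a : + 4 * T ≤ a
  4T≤a = begin
    + 4 * T                   ≤⟨ i≤k*i (0≤* (0≤+ 4) 0≤T) 1≤u ⟩
    u * (+ 4 * T)             ≡⟨ e u v ⟩
    u * u * (+ 4 * v)         ≤⟨ *-monoˡ-≤-0≤ 0≤u² (4*v≤[v+1]² 1≤v) ⟩
    a                         ∎
    where
    e : ∀ u v → u * (+ 4 * (u * v)) ≡ u * u * (+ 4 * v)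
    e = solve-∀

  3T≤a : + 3 * T ≤ a
  3T≤a = ℤP.≤-trans (*-monoʳ-≤-0≤ 0≤T (ℤ.+≤+ (ℕ.s≤s (ℕ.s≤s (ℕ.s≤s (ℕ.z≤n {1})))))) 4T≤a

  4≤a : + 4 ≤ a
  4≤a = ℤP.≤-trans (*-monoˡ-≤-0≤ (0≤+ 4) 1≤T) 4T≤a

  0≤a : 0ℤ ≤ a
  0≤a = ℤP.≤-trans (0≤+ 4) 4≤a

  T≤2[b-k] : T ≤ + 2 * (b - k)
  T≤2[b-k] = begin
    T                      ≤⟨ T≤b ⟩
    b                      ≤⟨ ℤP.i≤i+j b _ {{ℤ.nonNegative (ℤP.i≤j⇒0≤j-i 2k≤b)}} ⟩
    b + (b - + 2 * k)      ≡⟨ e b k ⟩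
    + 2 * (b - k)          ∎
    where
    e : ∀ b k → b + (b - + 2 * k) ≡ + 2 * (b - k)
    e = solve-∀

  3bT≤2a[b-k] : + 3 * b * T ≤ + 2 * a * (b - k)
  3bT≤2a[b-k] = begin
    + 3 * b * T                ≡⟨ e₁ b T ⟩
    b * (+ 3 * T)              ≤⟨ *-monoˡ-≤-0≤ 0≤b 3T≤a ⟩
    b * a                      ≤⟨ ℤP.i≤i+j (b * a) _ {{ℤ.nonNegative 0≤a[b-2k]}} ⟩
    b * a + a * (b - + 2 * k)  ≡⟨ e₂ a b k ⟩
    + 2 * a * (b - k)          ∎
    where
    0≤a[b-2k] = 0≤* 0≤a (ℤP.i≤j⇒0≤j-i 2k≤b)
    e₁ : ∀ b T → + 3 * b * T ≡ b * (+ 3 * T)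
    e₁ = solve-∀
    e₂ : ∀ a b k → b * a + a * (b - + 2 * k) ≡ + 2 * a * (b - k)
    e₂ = solve-∀

  aⁿ≡u²ⁿ*[v+1]²ⁿ : ∀ n → a ^ n ≡ (u * u) ^ n * (v + 1ℤ) ^ (2 ℕ.* n)
  aⁿ≡u²ⁿ*[v+1]²ⁿ n = trans (^-distribʳ-* (u * u) ((v + 1ℤ) * (v + 1ℤ)) n) (cong ((u * u) ^ n *_)
    (trans (cong (λ x → ((v + 1ℤ) * x) ^ n) (sym (ℤP.*-identityʳ (v + 1ℤ)))) (ℤP.^-*-assoc (v + 1ℤ) 2 n)))

  bⁿ≡u²ⁿ*vⁿ : ∀ n → b ^ n ≡ (u * u) ^ n * v ^ n
  bⁿ≡u²ⁿ*vⁿ = ^-distribʳ-* (u * u) v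

module CrossDifference
  {a b N D T : ℤ} (m : ℕ)
  (0≤a : 0ℤ ≤ a) (0≤b : 0ℤ ≤ b) (0≤T : 0ℤ ≤ T)
  (N-bounds : a ^ m * (a - + suc m * + 3) ≤ N × N ≤ a ^ suc m)
  (D-bounds : b ^ m * (b - + suc m) ≤ D × D ≤ b ^ suc m)
  (T≤2[b-k] : T ≤ + 2 * (b - + suc m)) (3bT≤2a[b-k] : + 3 * b * T ≤ + 2 * a * (b - + suc m))
  where

  N-lower = proj₁ N-bounds
  N-upper = proj₂ N-bounds
  D-lower = proj₁ D-bounds
  D-upper = proj₂ D-bounds

  k : ℤ
  k = + suc m

  0≤aᵐ : 0ℤ ≤ a ^ m
  0≤aᵐ = 0≤^ m 0≤a
  0≤bᵐ : 0ℤ ≤ b ^ m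
  0≤bᵐ = 0≤^ m 0≤b

  upper : (N * b ^ suc m - a ^ suc m * D) * T ≤ a ^ suc m * (+ 2 * k) * D
  upper = begin
    (N * b ^ suc m - a ^ suc m * D) * T
      ≤⟨ *-monoʳ-≤-0≤ 0≤T (minus-mono-≤ (*-monoʳ-≤-0≤ (0≤^ (suc m) 0≤b) N-upper)
                                    (*-monoˡ-≤-0≤ (0≤^ (suc m) 0≤a) D-lower)) ⟩
    (a ^ suc m * b ^ suc m - a ^ suc m * (b ^ m * (b - k))) * T
      ≡⟨ e₁ (a ^ suc m) b (b ^ m) k T ⟩
    a ^ suc m * b ^ m * k * T
      ≤⟨ *-monoˡ-≤-0≤ (0≤* (0≤* (0≤^ (suc m) 0≤a) 0≤bᵐ) (0≤+ (suc m))) T≤2[b-k] ⟩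
    a ^ suc m * b ^ m * k * (+ 2 * (b - k))
      ≡⟨ e₂ (a ^ suc m) b (b ^ m) k ⟩
    a ^ suc m * (+ 2 * k) * (b ^ m * (b - k))
      ≤⟨ *-monoˡ-≤-0≤ (0≤* (0≤^ (suc m) 0≤a) (0≤+ (2 ℕ.* suc m))) D-lower ⟩
    a ^ suc m * (+ 2 * k) * D ∎
    where
    e₁ : ∀ α b β k T → (α * (b * β) - α * (β * (b - k))) * T ≡ α * β * k * T
    e₁ = solve-∀
    e₂ : ∀ α b β k → α * β * k * (+ 2 * (b - k)) ≡ α * (+ 2 * k) * (β * (b - k))
    e₂ = solve-∀

  lower : (- (N * b ^ suc m - a ^ suc m * D)) * T ≤ a ^ suc m * (+ 2 * k) * D
  lower = begin
    (- (N * b ^ suc m - a ^ suc m * D)) * T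
      ≡⟨ cong (_* T) (e₁ N (b ^ suc m) (a ^ suc m) D) ⟩
    (a ^ suc m * D - N * b ^ suc m) * T
      ≤⟨ *-monoʳ-≤-0≤ 0≤T (minus-mono-≤ (*-monoˡ-≤-0≤ (0≤^ (suc m) 0≤a) D-upper)
                                    (*-monoʳ-≤-0≤ (0≤^ (suc m) 0≤b) N-lower)) ⟩
    (a ^ suc m * b ^ suc m - a ^ m * (a - k * + 3) * b ^ suc m) * T
      ≡⟨ e₂ a (a ^ m) b (b ^ m) k T ⟩
    k * a ^ m * b ^ m * (+ 3 * b * T)
      ≤⟨ *-monoˡ-≤-0≤ (0≤* (0≤* (0≤+ (suc m)) 0≤aᵐ) 0≤bᵐ) 3bT≤2a[b-k] ⟩
    k * a ^ m * b ^ m * (+ 2 * a * (b - k))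
      ≡⟨ e₃ a (a ^ m) b (b ^ m) k ⟩
    a ^ suc m * (+ 2 * k) * (b ^ m * (b - k))
      ≤⟨ *-monoˡ-≤-0≤ (0≤* (0≤^ (suc m) 0≤a) (0≤+ (2 ℕ.* suc m))) D-lower ⟩
    a ^ suc m * (+ 2 * k) * D ∎
    where
    e₁ : ∀ N β α D → - (N * β - α * D) ≡ α * D - N * β
    e₁ = solve-∀
    e₂ : ∀ a α b β k T → (a * α * (b * β) - α * (a - k * + 3) * (b * β)) * T ≡ k * α * β * (+ 3 * b * T)
    e₂ = solve-∀
    e₃ : ∀ a α b β k → k * α * β * (+ 2 * a * (b - k)) ≡ a * α * (+ 2 * k) * (β * (b - k))
    e₃ = solve-∀

  bound : + ∣ N * b ^ suc m - a ^ suc m * D ∣ * T ≤ a ^ suc m * (+ 2 * k) * D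
  bound = +∣i∣*j≤k {N * b ^ suc m - a ^ suc m * D} upper lower

common-factor-cancel : ∀ {W N P Q D S T} → 1ℤ ≤ W →
  + ∣ N * (W * Q) - W * P * D ∣ * T ≤ W * P * S * D → + ∣ N * Q - P * D ∣ * T ≤ P * S * D
common-factor-cancel {W} {N} {P} {Q} {D} {S} {T} 1≤W bound =
  ℤP.*-cancelʳ-≤-pos _ _ W {{ℤ.positive (ℤP.suc[i]≤j⇒i<j 1≤W)}} (begin
    + ∣ N * Q - P * D ∣ * T * W             ≡⟨ e₁ (+ ∣ N * Q - P * D ∣) T W ⟩
    + ∣ N * Q - P * D ∣ * W * T             ≡⟨ cong (_* T) (+∣i*j∣≡+∣i∣*j (N * Q - P * D) 0≤W) ⟨
    + ∣ (N * Q - P * D) * W ∣ * T           ≡⟨ cong (λ z → + ∣ z ∣ * T) (e₂ N P Q D W) ⟩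
    + ∣ N * (W * Q) - W * P * D ∣ * T       ≤⟨ bound ⟩
    W * P * S * D                           ≡⟨ e₃ W P S D ⟩
    P * S * D * W                           ∎)
  where
  0≤W = ℤP.≤-trans (0≤+ 1) 1≤W
  e₁ : ∀ z T W → z * T * W ≡ z * W * T
  e₁ = solve-∀
  e₂ : ∀ N P Q D W → (N * Q - P * D) * W ≡ N * (W * Q) - W * P * D
  e₂ = solve-∀
  e₃ : ∀ W P S D → W * P * S * D ≡ P * S * D * W
  e₃ = solve-∀

toℚᵘ-ℤ→ℚ : ∀ z → toℚᵘ (ℤ→ℚ z) ≃ᵘ mkℚᵘ z 0
toℚᵘ-ℤ→ℚ z = ℚP.toℚᵘ-fromℚᵘ (mkℚᵘ z 0)

ℤ→ℚ-≢0 : ∀ {z} → 1ℤ ≤ z → ℤ→ℚ z ≢ 0ℚ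
ℤ→ℚ-≢0 {z} 1≤z z≡0 with ℚᵘP.≃-trans (ℚᵘP.≃-sym (toℚᵘ-ℤ→ℚ z)) (ℚP.toℚᵘ-cong z≡0)
... | *≡* z*1≡0 with subst (1ℤ ≤_) (trans (sym (ℤP.*-identityʳ z)) z*1≡0) 1≤z
... | ℤ.+≤+ ()

/ℚ-*-cancel : ∀ p {q} → q ≢ 0ℚ → (p /ℚ q) ℚ.* q ≡ p
/ℚ-*-cancel p {q} q≢0 with q ℚ.≟ 0ℚ
... | yes q≡0 = ⊥-elim (q≢0 q≡0)
... | no _ = trans (ℚP.*-assoc p (ℚ.1/ q) q) (trans (cong (p ℚ.*_) (ℚP.*-inverseˡ q)) (ℚP.*-identityʳ p))
  where instance _ = ℚ.≢-nonZero q≢0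

↥*≡*↧ : ∀ x N D → x ℚ.* ℤ→ℚ D ≡ ℤ→ℚ N → ℚ.↥ x * D ≡ N * ℚ.↧ x
↥*≡*↧ x@(mkℚ a α-1 _) N D x*D≡N
  with ℚᵘP.≃-trans (ℚᵘP.*-congˡ {toℚᵘ x} (ℚᵘP.≃-sym (toℚᵘ-ℤ→ℚ D)))
        (ℚᵘP.≃-trans (ℚᵘP.≃-sym (ℚP.toℚᵘ-homo-* x (ℤ→ℚ D)))
          (ℚᵘP.≃-trans (ℚP.toℚᵘ-cong x*D≡N) (toℚᵘ-ℤ→ℚ N)))
... | *≡* e = trans (sym (ℤP.*-identityʳ (a * D))) (trans e (cong (N *_) (ℤP.*-identityʳ (+ suc α-1))))

-- The shape of `*≤*` for ∣ a/α′ − b/β′ ∣ ≤ (b/β′)(c/γ′), where these fractions equal N/D, P/Q and S/T.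
cross-multiplied-bound :
  ∀ {a b c N D P Q S T} α β γ → 1ℤ ≤ D → 1ℤ ≤ Q → 1ℤ ≤ T →
  a * D ≡ N * + suc α → b * Q ≡ P * + suc β → c * T ≡ S * + suc γ →
  + ∣ N * Q - P * D ∣ * T ≤ P * S * D →
  + ∣ a * + suc β + - b * + suc α ∣ * (+ suc β * + suc γ) ≤ b * c * (+ suc α * + suc β)
cross-multiplied-bound {a} {b} {c} {N} {D} {P} {Q} {S} {T} α β γ 1≤D 1≤Q 1≤T aD≡Nα bQ≡Pβ cT≡Sγ bound =
  ℤP.*-cancelʳ-≤-pos _ _ (D * Q * T) {{ℤ.positive (ℤP.suc[i]≤j⇒i<j 1≤DQT)}} (begin
    + ∣ z ∣ * (β′ * γ′) * (D * Q * T)       ≡⟨ e₁ (+ ∣ z ∣) β′ γ′ D Q T ⟩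
    + ∣ z ∣ * (D * Q) * (β′ * γ′ * T)       ≡⟨ cong (_* (β′ * γ′ * T)) (+∣i*j∣≡+∣i∣*j z 0≤DQ) ⟨
    + ∣ z * (D * Q) ∣ * (β′ * γ′ * T)
      ≡⟨ cong (λ w → + ∣ w ∣ * (β′ * γ′ * T)) z*DQ≡[NQ-PD]*αβ ⟩
    + ∣ (N * Q - P * D) * (α′ * β′) ∣ * (β′ * γ′ * T)
      ≡⟨ cong (_* (β′ * γ′ * T)) (+∣i*j∣≡+∣i∣*j (N * Q - P * D) (0≤+ (suc α ℕ.* suc β))) ⟩
    + ∣ N * Q - P * D ∣ * (α′ * β′) * (β′ * γ′ * T)
      ≡⟨ e₂ (+ ∣ N * Q - P * D ∣) (α′ * β′) β′ γ′ T ⟩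
    α′ * β′ * (β′ * γ′) * (+ ∣ N * Q - P * D ∣ * T)
      ≤⟨ *-monoˡ-≤-0≤ (0≤+ (suc α ℕ.* suc β ℕ.* (suc β ℕ.* suc γ))) bound ⟩
    α′ * β′ * (β′ * γ′) * (P * S * D)       ≡⟨ e₃ α′ β′ γ′ P S D ⟩
    (P * β′) * (S * γ′) * (α′ * β′ * D)
      ≡⟨ cong₂ (λ x y → x * y * (α′ * β′ * D)) bQ≡Pβ cT≡Sγ ⟨
    (b * Q) * (c * T) * (α′ * β′ * D)       ≡⟨ e₄ b c α′ β′ D Q T ⟩
    b * c * (α′ * β′) * (D * Q * T)         ∎)
  where
  α′ β′ γ′ z : ℤ
  α′ = + suc α
  β′ = + suc β
  γ′ = + suc γ
  z = a * β′ + - b * α′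
  1≤DQT : 1ℤ ≤ D * Q * T
  1≤DQT = 1≤* (1≤* 1≤D 1≤Q) 1≤T
  0≤DQ : 0ℤ ≤ D * Q
  0≤DQ = ℤP.≤-trans (0≤+ 1) (1≤* 1≤D 1≤Q)
  e₁ : ∀ z β γ D Q T → z * (β * γ) * (D * Q * T) ≡ z * (D * Q) * (β * γ * T)
  e₁ = solve-∀
  e₂ : ∀ z αβ β γ T → z * αβ * (β * γ * T) ≡ αβ * (β * γ) * (z * T)
  e₂ = solve-∀
  e₃ : ∀ α β γ P S D → α * β * (β * γ) * (P * S * D) ≡ (P * β) * (S * γ) * (α * β * D)
  e₃ = solve-∀
  e₄ : ∀ b c α β D Q T → (b * Q) * (c * T) * (α * β * D) ≡ b * c * (α * β) * (D * Q * T)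
  e₄ = solve-∀
  e₅ : ∀ a b α β D Q → (a * β + - b * α) * (D * Q) ≡ (a * D) * (β * Q) - (b * Q) * (α * D)
  e₅ = solve-∀
  e₆ : ∀ N P α β D Q → (N * α) * (β * Q) - (P * β) * (α * D) ≡ (N * Q - P * D) * (α * β)
  e₆ = solve-∀

  z*DQ≡[NQ-PD]*αβ : z * (D * Q) ≡ (N * Q - P * D) * (α′ * β′)
  z*DQ≡[NQ-PD]*αβ = begin-equality
    z * (D * Q)                              ≡⟨ e₅ a b α′ β′ D Q ⟩
    (a * D) * (β′ * Q) - (b * Q) * (α′ * D)
      ≡⟨ cong₂ (λ x y → x * (β′ * Q) - y * (α′ * D)) aD≡Nα bQ≡Pβ ⟩
    (N * α′) * (β′ * Q) - (P * β′) * (α′ * D) ≡⟨ e₆ N P α′ β′ D Q ⟩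
    (N * Q - P * D) * (α′ * β′)              ∎

∣x-r∣≃ᵘ : ∀ x r → toℚᵘ (ℚ.∣ x ℚ.- r ∣) ≃ᵘ ℚᵘ.∣ toℚᵘ x ℚᵘ.- toℚᵘ r ∣
∣x-r∣≃ᵘ x r = ℚᵘP.≃-trans (ℚP.toℚᵘ-homo-∣-∣ (x ℚ.- r)) (ℚᵘP.∣-∣-cong
  (ℚᵘP.≃-trans (ℚP.toℚᵘ-homo-+ x (ℚ.- r)) (ℚᵘP.+-congʳ (toℚᵘ x) (ℚP.toℚᵘ-homo‿- r))))

quotient-deviation : ∀ {N D P Q S T} → 1ℤ ≤ D → 1ℤ ≤ Q → 1ℤ ≤ T →
  + ∣ N * Q - P * D ∣ * T ≤ P * S * D →
  ℚ.∣ ℤ→ℚ N /ℚ ℤ→ℚ D ℚ.- ℤ→ℚ P /ℚ ℤ→ℚ Q ∣ ℚ.≤ (ℤ→ℚ P /ℚ ℤ→ℚ Q) ℚ.* (ℤ→ℚ S /ℚ ℤ→ℚ T)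
quotient-deviation {N} {D} {P} {Q} {S} {T} 1≤D 1≤Q 1≤T bound =
  from-cross-multiplied (ℤ→ℚ N /ℚ ℤ→ℚ D) (ℤ→ℚ P /ℚ ℤ→ℚ Q) (ℤ→ℚ S /ℚ ℤ→ℚ T)
    (cross N 1≤D) (cross P 1≤Q) (cross S 1≤T)
  where
  cross : ∀ M {E} → 1ℤ ≤ E → ℚ.↥ (ℤ→ℚ M /ℚ ℤ→ℚ E) * E ≡ M * ℚ.↧ (ℤ→ℚ M /ℚ ℤ→ℚ E)
  cross M {E} 1≤E = ↥*≡*↧ (ℤ→ℚ M /ℚ ℤ→ℚ E) M E (/ℚ-*-cancel (ℤ→ℚ M) (ℤ→ℚ-≢0 1≤E))
  from-cross-multiplied : ∀ x r s →
    ℚ.↥ x * D ≡ N * ℚ.↧ x → ℚ.↥ r * Q ≡ P * ℚ.↧ r → ℚ.↥ s * T ≡ S * ℚ.↧ s → ℚ.∣ x ℚ.- r ∣ ℚ.≤ r ℚ.* s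
  from-cross-multiplied x@(mkℚ a α _) r@(mkℚ b β _) s@(mkℚ c γ _) xD≡N rQ≡P sT≡S =
    ℚP.toℚᵘ-cancel-≤ (ℚᵘP.≤-respˡ-≃ (ℚᵘP.≃-sym (∣x-r∣≃ᵘ x r))
      (ℚᵘP.≤-respʳ-≃ (ℚᵘP.≃-sym (ℚP.toℚᵘ-homo-* r s)) (*≤*
        (cross-multiplied-bound {a} {b} {c} {N} {D} {P} {Q} {S} {T} α β γ 1≤D 1≤Q 1≤T xD≡N rQ≡P sT≡S bound))))

lemma4p4 : (U V X : ℤ) → + 1 ℤ.≤ V → + 1 ℤ.≤ X → (+ 2) ℤ.* X ℤ.≤ + ∣ U ∣ →
    let ρ : ℚ
        ρ = ℤ→ℚ ((V ℤ.+ + 1) ℤ.^ ∣ + 2 ℤ.* X ∣) /ℚ ℤ→ℚ (V ℤ.^ ∣ X ∣)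
        num : ℚ
        num = ℤ→ℚ (ψ (+ 2 ℤ.* X ℤ.+ + 1) (U ℤ.* (V ℤ.+ + 1)))
        den : ℚ
        den = ℤ→ℚ (ψ (X ℤ.+ + 1) (U ℤ.* U ℤ.* V))
    in (den ≢ ℚ.0ℚ)
       × (ℚ.∣ (num /ℚ den) ℚ.- ρ ∣ ℚ.≤ ρ ℚ.* (ℤ→ℚ (+ 2 ℤ.* X) /ℚ ℤ→ℚ (+ ∣ U ∣ ℤ.* V)))
lemma4p4 U V (+ zero) _ (ℤ.+≤+ ()) _
lemma4p4 U V X@(+ suc m) 1≤V 1≤X 2X≤∣U∣ =
  ℤ→ℚ-≢0 1≤D , quotient-deviation {N} {D} {P} {Q} {+ 2 * X} {T} 1≤D (1≤^ n 1≤V) 1≤T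
    (common-factor-cancel {W} {N} {P} {Q} {D} (1≤^ n 1≤u²)
      (subst₂ (λ α β → + ∣ N * β - α * D ∣ * T ≤ α * (+ 2 * X) * D)
        (aⁿ≡u²ⁿ*[v+1]²ⁿ n) (bⁿ≡u²ⁿ*vⁿ n)
        (CrossDifference.bound m 0≤a 0≤b 0≤T N-bounds D-bounds T≤2[b-k] 3bT≤2a[b-k])))
  where
  open Parameters {+ ∣ U ∣} {V} {X} 1≤X 2X≤∣U∣ 1≤V
  n : ℕ
  n = suc m
  N D W P Q : ℤ
  N = ψℕ (2 ℕ.* n ℕ.+ 1) (U * (V + 1ℤ))
  D = ψℕ (n ℕ.+ 1) (U * U * V)
  W = (+ ∣ U ∣ * + ∣ U ∣) ^ n
  P = (V + 1ℤ) ^ (2 ℕ.* n)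
  Q = V ^ n
  N-bounds : a ^ m * (a - X * + 3) ≤ N × N ≤ a ^ n
  N-bounds = ψℕ-odd-sandwich m ([i*j]²≡∣i∣²*j² U (V + 1ℤ)) 4≤a
  D≡ψℕ[2+m]b : D ≡ ψℕ (2 ℕ.+ m) b
  D≡ψℕ[2+m]b = cong₂ ψℕ (ℕP.+-comm n 1) (cong (_* V) (i*i≡∣i∣*∣i∣ U))
  D-bounds : b ^ m * (b - X) ≤ D × D ≤ b ^ n
  D-bounds = subst (λ d → b ^ m * (b - X) ≤ d × d ≤ b ^ n) (sym D≡ψℕ[2+m]b)
               (ψℕ-suc-sandwich m 2≤b)
  1≤D : 1ℤ ≤ D
  1≤D = subst (1ℤ ≤_) (sym D≡ψℕ[2+m]b) (1≤ψℕ-suc n 2≤b)
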